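{- Let $G$ be a non-planar ribbon graph that contains a subgraph (with the inherited ribbon structure) of type I. Then $G$ is of type A.
   Context: A ribbon graph is a finite connected graph with, at each vertex, a cyclic ordering of the incident edges; a subgraph inherits the ribbon structure by restricting these cyclic orders. Non-planar means $G$ cannot be drawn in the plane without crossings so that the counterclockwise order at each vertex agrees with the cyclic ordering. Type I: a ribbon graph $H$ consisting of distinct vertices $c,b,a_1,\dots,a_n,d_1,\dots,d_m,f_1,\dots,f_k$ ($n,m,k\ge 0$) and three internally vertex-disjoint paths $P_a=(c,a_1,\dots,a_n,b)$, $P_d=(c,d_1,\dots,d_m,b)$, $P_f=(c,f_1,\dots,f_k,b)$. Write $ca_1,cd_1,cf_1$ for the first edges of $P_a,P_d,P_f$ (at $c$) and $ba_n,bd_m,bf_k$ for their last edges (at $b$); e.g. if $n=0$ both $ca_1$ and $ba_n$ denote the edge $cb$ of $P_a$. The cyclic order at $c$ in $H$ is $(ca_1,cd_1,cf_1)$ and at $b$ is $(bf_k,ba_n,bd_m)$. $H$-decomposition: suppose $H\subseteq G$ is of type I. Write the cyclic ordering of the edges at $c$ in $G$ as $(ca_1,cx_1,\dots,cx_N,cd_1,cy_1,\dots,cy_M)$, $N\ge0$ (so $cf_1$ is among the $cy_j$). Let $G_1$ be the subgraph of $G$ formed by all edges $e$ for which there is a path whose first edge is some $cx_i$ and whose last edge is $e$ and which uses $c$ only at its endpoints (if there are no such edges, $G_1$ is the single vertex $c$). $G$ is of type A if it contains a type I subgraph $H$ for which $G_1$ contains no vertex of $V(H)\setminus\{c\}$.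 -}

module Defs where

open import Data.Nat using (ℕ; zero; suc; _+_; _*_; _≤_; _<_; _≤?_)
open import Data.Fin using (Fin; toℕ; inject₁) renaming (zero to fzero; suc to fsuc)
open import Data.List using (List; []; _∷_; _++_; length; filter; upTo; allFin)
open import Data.List.Relation.Unary.All using (All; all?)
open import Data.List.Relation.Unary.Unique.Propositional using (Unique)
open import Data.List.Membership.Propositional using (_∉_)
open import Data.Vec using (Vec; lookup; head; last; toList; _∷ʳ_) renaming (_∷_ to _∷v_)
open import Data.Product using (Σ; _×_)
open import Data.Sum using (_⊎_)
open import Relation.Binary.PropositionalEquality using (_≡_; _≢_)
open import Relation.Binary.Construct.Closure.ReflexiveTransitive using (Star)
open import Relation.Nullary using (Dec)

iter : {A : Set} → (A → A) → ℕ → A → A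
iter f zero    x = x
iter f (suc k) x = f (iter f k x)

-- A ribbon graph (combinatorial map, multigraph, loops allowed) on
-- vertices Fin nV and half-edges (darts) Fin nD.
--   vert d : the vertex at which dart d is attached
--   α      : fixed-point-free involution pairing the two darts of an edge
--   σ      : rotation; σ d is the next dart counterclockwise at vert d;
--            the darts at each vertex form a single σ-cycle.
record RibbonGraph : Set where
  field
    nV nD  : ℕ
    vert   : Fin nD → Fin nV
    α      : Fin nD → Fin nD
    α-inv  : ∀ d → α (α d) ≡ d
    α-free : ∀ d → α d ≢ d
    σ      : Fin nD → Fin nD
    σ⁻¹    : Fin nD → Fin nD
    σσ⁻¹   : ∀ d → σ (σ⁻¹ d) ≡ d
    σ⁻¹σ   : ∀ d → σ⁻¹ (σ d) ≡ d
    σ-vert : ∀ d → vert (σ d) ≡ vert d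
    σ-cyc  : ∀ d e → vert d ≡ vert e → Σ ℕ λ k → iter σ k d ≡ e

  V : Set
  V = Fin nV

  D : Set
  D = Fin nD

  Adj : V → V → Set
  Adj u w = Σ D λ d → vert d ≡ u × vert (α d) ≡ w

  φ : D → D
  φ d = σ (α d)

  -- d is the (toℕ-)least dart of its face (φ-orbit)
  FaceRep : D → Set
  FaceRep d = All (λ k → toℕ d ≤ toℕ (iter φ k d)) (upTo nD)

  faceRep? : (d : D) → Dec (FaceRep d)
  faceRep? d = all? (λ k → toℕ d ≤? toℕ (iter φ k d)) (upTo nD)

  nF : ℕ
  nF = length (filter faceRep? (allFin nD))

open RibbonGraph public

Connected : RibbonGraph → Set
Connected G = ∀ (u w : V G) → Star (Adj G) u w

-- Planar (genus 0): Euler's formula V - E + F = 2 with E = nD/2,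
-- written as 2V + 2F = 4 + nD (the edgeless graph counts as planar).
Planar : RibbonGraph → Set
Planar G = nD G ≡ 0 ⊎ 2 * nV G + 2 * nF G ≡ 4 + nD G

module _ (G : RibbonGraph) where
  private
    V' = V G
    D' = D G
    σG = σ G
    αG = α G
    vG = vert G

  -- The restriction of the cyclic order at a vertex to the three darts
  -- x, y, z is (x, y, z): going around from x one meets y strictly
  -- before z, within one turn.
  Cyc3 : D' → D' → D' → Set
  Cyc3 x y z = Σ ℕ λ i → Σ ℕ λ j →
    0 < i × i < j × iter σG i x ≡ y × iter σG j x ≡ z ×
    (∀ l → 0 < l → l ≤ j → iter σG l x ≢ x)

  -- the darts ds form a path with vertex sequence vs
  -- (the i-th dart leaves vs[i] and arrives at vs[i+1])
  IsPath : ∀ {n} → Vec V' (suc (suc n)) → Vec D' (suc n) → Set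
  IsPath {n} vs ds = ∀ (i : Fin (suc n)) →
    vG (lookup ds i) ≡ lookup vs (inject₁ i) ×
    vG (αG (lookup ds i)) ≡ lookup vs (fsuc i)

  -- a walk whose first dart is e and last dart is e', never passing
  -- through c except possibly at its two ends
  data WalkAvoid (c : V') : D' → D' → Set where
    one  : ∀ e → WalkAvoid c e e
    step : ∀ {e e' e''} → vG (αG e) ≢ c → vG e' ≡ vG (αG e) →
           WalkAvoid c e' e'' → WalkAvoid c e e''

  record TypeI : Set where
    field
      c b     : V'
      n m k   : ℕ
      as      : Vec V' n
      ds      : Vec V' m
      fs      : Vec V' k
      Pa      : Vec D' (suc n)
      Pd      : Vec D' (suc m)
      Pf      : Vec D' (suc k)
      Pa-path : IsPath (c ∷v (as ∷ʳ b)) Pa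
      Pd-path : IsPath (c ∷v (ds ∷ʳ b)) Pd
      Pf-path : IsPath (c ∷v (fs ∷ʳ b)) Pf
      distinct : Unique (c ∷ b ∷ toList as ++ toList ds ++ toList fs)
      cyc-c   : Cyc3 (head Pa) (head Pd) (head Pf)
      cyc-b   : Cyc3 (αG (last Pf)) (αG (last Pa)) (αG (last Pd))

    VH-c : List V'
    VH-c = b ∷ toList as ++ toList ds ++ toList fs

    -- y is one of the darts cx₁ … cx_N strictly between ca₁ and cd₁
    -- in the cyclic order at c in G
    IsCx : D' → Set
    IsCx y = Σ ℕ λ l → 0 < l × iter σG l (head Pa) ≡ y ×
      (∀ l' → 0 < l' → l' ≤ l → iter σG l' (head Pa) ≢ head Pd)

    -- G₁ contains no vertex of V'(H) \ {c}: every edge e of G₁ (last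
    -- edge of a walk starting with some cxᵢ and meeting c only at its
    -- ends) has both endpoints outside V'(H) \ {c}.  (If G₁ is the single
    -- vertex c this holds trivially.)
    G₁-avoids : Set
    G₁-avoids = ∀ y e → IsCx y → WalkAvoid c y e →
      vG e ∉ VH-c × vG (αG e) ∉ VH-c

  TypeA : Set
  TypeA = Σ TypeI λ H → TypeI.G₁-avoids H

-- Induction on the number of darts strictly between ca₁ and cd₁ at c.  If G₁
-- meets V(H) ∖ {c}, some cxₗ starts a walk that avoids c and first meets H at a
-- vertex v; shortcutting it gives a path X from c through cxₗ whose interior is
-- disjoint from H.  Splicing X into H gives a type I subgraph in which cd₁ is
-- closer to ca₁: if v lies on P_a or P_d, X replaces the segment of that path up
-- to v; if v = b, X replaces P_a or P_d according to where its last edge falls in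
-- the rotation at b; if v lies on P_f, v becomes the new b, the part of P_f
-- beyond v is appended to P_a or P_d, and X replaces the other one, according to
-- the rotation at v.  Whether such a walk exists is decided by a search of depth
-- |V(G)|, which suffices because walks can be shortcut to simple ones.

module Submission where

open import Defs
open import Data.Nat using (ℕ; zero; suc; _+_; _<_; _≤_; _∸_; z≤n; s≤s; s≤s⁻¹)
open import Data.Nat.Properties
open import Data.Nat.Induction using (<-wellFounded)
open import Induction.WellFounded using (Acc; acc)
open import Data.Fin using (Fin; toℕ; zero; suc)
import Data.Fin.Properties as Finₚ
open import Data.List using (List; []; _∷_; _++_; [_]; length; reverse)
open import Data.List.Properties using (unfold-reverse)
import Data.List as List
open import Data.List.Membership.Propositional using (_∈_; _∉_)
open import Data.List.Membership.Propositional.Properties using (∈-lookup; ∈-++⁺ˡ; ∈-++⁺ʳ; ∈-++⁻)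
import Data.List.Membership.DecPropositional as DecMembership
open import Data.List.Relation.Unary.Any using (here; there)
open import Data.List.Relation.Unary.All using (All; []; _∷_)
import Data.List.Relation.Unary.All as All
import Data.List.Relation.Unary.All.Properties as Allₚ
open import Data.List.Relation.Unary.AllPairs using ([]; _∷_)
open import Data.List.Relation.Binary.Subset.Propositional using (_⊆_)
open import Data.List.Relation.Unary.Unique.Propositional using (Unique)
open import Data.List.Relation.Unary.Unique.Propositional.Properties using (Unique[x∷xs]⇒x∉xs; ++⁺)
open import Data.List.Relation.Binary.Permutation.Propositional using (_↭_; ↭-refl; ↭-sym; ↭-trans; ↭⇒↭ₛ)
open import Data.List.Relation.Binary.Permutation.Propositional.Properties using (++-commutativeMonoid; ↭-reverse; ++⁺ʳ)
import Data.List.Relation.Binary.Permutation.Setoid.Properties as Permutationₛ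
open import Data.Product using (Σ; ∃; ∃₂; _×_; _,_; proj₁; proj₂)
open import Data.Sum using (_⊎_; inj₁; inj₂)
open import Relation.Binary.Definitions using (tri<; tri≈; tri>)
open import Data.Empty using (⊥)
open import Function.Base using (_∘_)
open import Function.Definitions using (Injective)
open import Data.Vec using (Vec; _∷ʳ_)
import Data.Vec as Vec
open import Data.Vec.Properties using (toList∘fromList)
open import Relation.Nullary using (¬_; Dec; yes; no; contradiction)
open import Relation.Nullary.Decidable using (_×-dec_; _⊎-dec_; ¬?)
open import Relation.Unary using (Decidable)
open import Relation.Binary.PropositionalEquality
  using (_≡_; _≢_; refl; sym; trans; cong; cong₂; subst; setoid; module ≡-Reasoning)

module _ {A : Set} (f : A → A) where

  iter-+ : ∀ m n x → iter f (m + n) x ≡ iter f m (iter f n x)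
  iter-+ zero    n x = refl
  iter-+ (suc m) n x = cong f (iter-+ m n x)

  iter-commute : ∀ n x → iter f n (f x) ≡ f (iter f n x)
  iter-commute zero    x = refl
  iter-commute (suc n) x = cong f (iter-commute n x)

  iter-injective : Injective _≡_ _≡_ f → ∀ n → Injective _≡_ _≡_ (iter f n)
  iter-injective f-inj zero    eq = eq
  iter-injective f-inj (suc n) eq = iter-injective f-inj n (f-inj eq)

  iter-invariant : ∀ {B : Set} (g : A → B) → (∀ x → g (f x) ≡ g x) → ∀ n x → g (iter f n x) ≡ g x
  iter-invariant g inv zero    x = refl
  iter-invariant g inv (suc n) x = trans (inv (iter f n x)) (iter-invariant g inv n x)

record Least (P : ℕ → Set) : Set where
  field
    value : ℕ
    holds : P value
    below : ∀ {k} → k < value → ¬ P k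

least-witness : ∀ {P : ℕ → Set} → Decidable P → ∀ n → P n → Least P
least-witness {P} P? n = go n (<-wellFounded n)
  where
    go : ∀ n → Acc _<_ n → P n → Least P
    go n (acc smaller) pn with anyUpTo? P? n
    ... | yes (k , k<n , pk) = go k (smaller k<n) pk
    ... | no  none           = record { value = n ; holds = pn ; below = λ k<n pk → none (_ , k<n , pk) }

module _ {A : Set} where

  Unique-++⁻ˡ : ∀ xs {ys : List A} → Unique (xs ++ ys) → Unique xs
  Unique-++⁻ˡ []       _             = []
  Unique-++⁻ˡ (x ∷ xs) (x∉ys ∷ uniq) = Allₚ.++⁻ˡ xs x∉ys ∷ Unique-++⁻ˡ xs uniq

  Unique-++⁻ʳ : ∀ xs {ys : List A} → Unique (xs ++ ys) → Unique ys
  Unique-++⁻ʳ []       uniq       = uniq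
  Unique-++⁻ʳ (x ∷ xs) (_ ∷ uniq) = Unique-++⁻ʳ xs uniq

  Unique-++⇒∉ : ∀ xs {ys : List A} {x} → Unique (xs ++ ys) → x ∈ xs → x ∉ ys
  Unique-++⇒∉ (_ ∷ xs) (x∉ ∷ _)    (here refl)  x∈ys = Allₚ.All¬⇒¬Any x∉ (∈-++⁺ʳ xs x∈ys)
  Unique-++⇒∉ (_ ∷ xs) (_ ∷ uniq) (there x∈xs) x∈ys = Unique-++⇒∉ xs uniq x∈xs x∈ys

  Unique-resp-↭ : ∀ {xs ys : List A} → xs ↭ ys → Unique xs → Unique ys
  Unique-resp-↭ p = Permutationₛ.Unique-resp-↭ (setoid A) (↭⇒↭ₛ p)

  ↭-via-reverse : ∀ {N O : List A} xs R → N ↭ reverse xs ++ R → xs ++ R ↭ O → N ↭ O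
  ↭-via-reverse xs R N↭ ↭O = ↭-trans N↭ (↭-trans (++⁺ʳ R (↭-reverse xs)) ↭O)

  Unique⇒lookup-injective : ∀ {xs : List A} → Unique xs → ∀ i j → toℕ i < toℕ j →
                            List.lookup xs i ≢ List.lookup xs j
  Unique⇒lookup-injective (x∉ ∷ _)    zero    (suc j) _   eq =
    Allₚ.All¬⇒¬Any x∉ (subst (_∈ _) (sym eq) (∈-lookup j))
  Unique⇒lookup-injective (_ ∷ uniq) (suc i) (suc j) i<j eq = Unique⇒lookup-injective uniq i j (s≤s⁻¹ i<j) eq

Unique⇒length≤ : ∀ {n} {xs : List (Fin n)} → Unique xs → length xs ≤ n
Unique⇒length≤ {n} {xs} uniq with length xs ≤? n
... | yes ≤n = ≤n
... | no  ≰n with Finₚ.pigeonhole (≰⇒> ≰n) (List.lookup xs)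
...   | i , j , i<j , eq = contradiction eq (Unique⇒lookup-injective uniq i j i<j)

module _ (G : RibbonGraph) where

  -- Rotation at a vertex

  rotate : ℕ → D G → D G
  rotate = iter (σ G)

  target : D G → V G
  target d = vert G (α G d)

  target-α : ∀ d → target (α G d) ≡ vert G d
  target-α d = cong (vert G) (α-inv G d)

  σ-injective : Injective _≡_ _≡_ (σ G)
  σ-injective {x} {y} eq = trans (sym (σ⁻¹σ G x)) (trans (cong (σ⁻¹ G) eq) (σ⁻¹σ G y))

  α-injective : Injective _≡_ _≡_ (α G)
  α-injective {x} {y} eq = trans (sym (α-inv G x)) (trans (cong (α G) eq) (α-inv G y))

  vert-rotate : ∀ n x → vert G (rotate n x) ≡ vert G x
  vert-rotate = iter-invariant (σ G) (vert G) (σ-vert G)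

  rotate-+ : ∀ m n x → rotate (m + n) x ≡ rotate m (rotate n x)
  rotate-+ = iter-+ (σ G)

  rotate-injective : ∀ n → Injective _≡_ _≡_ (rotate n)
  rotate-injective = iter-injective (σ G) σ-injective

  NoReturn : D G → ℕ → Set
  NoReturn x j = ∀ l → 0 < l → l ≤ j → rotate l x ≢ x

  NoReturn⇒injective : ∀ {x j m n} → NoReturn x j → m < n → n ≤ j → rotate m x ≢ rotate n x
  NoReturn⇒injective {x} {j} {m} {n} noReturn m<n n≤j eq =
    noReturn (n ∸ m) (m<n⇒0<n∸m m<n) (≤-trans (m∸n≤m n m) n≤j) (sym x≡rotate[n∸m]x)
    where
      x≡rotate[n∸m]x : x ≡ rotate (n ∸ m) x
      x≡rotate[n∸m]x = rotate-injective m (begin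
        rotate m x               ≡⟨ eq ⟩
        rotate n x               ≡⟨ cong (λ t → rotate t x) (sym (m+[n∸m]≡n (<⇒≤ m<n))) ⟩
        rotate (m + (n ∸ m)) x   ≡⟨ rotate-+ m (n ∸ m) x ⟩
        rotate m (rotate (n ∸ m) x) ∎)
        where open ≡-Reasoning

  record Period (p : D G) : Set where
    field
      T       : ℕ
      0<T     : 0 < T
      returns : rotate T p ≡ p
      minimal : ∀ {l} → 0 < l → l < T → rotate l p ≢ p

  period : ∀ p → Period p
  period p = record
    { T = value ; 0<T = proj₁ holds ; returns = proj₂ holds
    ; minimal = λ 0<l l<T eq → below l<T (0<l , eq) }
    where
      returns? : Decidable (λ t → 0 < t × rotate t p ≡ p)
      returns? t = (0 <? t) ×-dec (rotate t p Finₚ.≟ p)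

      k : ℕ
      k = proj₁ (σ-cyc G (σ G p) p (σ-vert G p))

      rotate[1+k]p≡p : rotate (suc k) p ≡ p
      rotate[1+k]p≡p = trans (sym (iter-commute (σ G) k p)) (proj₂ (σ-cyc G (σ G p) p (σ-vert G p)))

      open Least (least-witness returns? (suc k) (s≤s z≤n , rotate[1+k]p≡p))

  record Index (p q : D G) : Set where
    field
      steps   : ℕ
      <period : steps < Period.T (period p)
      reaches : rotate steps p ≡ q

  index : ∀ {p q} → vert G p ≡ vert G q → Index p q
  index {p} {q} p~q = record { steps = value ; <period = value<T ; reaches = holds }
    where
      open Least (least-witness (λ t → rotate t p Finₚ.≟ q)
                                (proj₁ (σ-cyc G p q p~q)) (proj₂ (σ-cyc G p q p~q)))
      open Period (period p)

      value<T : value < T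
      value<T with value <? T
      ... | yes value<T = value<T
      ... | no  value≮T = contradiction (begin
          rotate (value ∸ T) p             ≡⟨ cong (rotate (value ∸ T)) returns ⟨
          rotate (value ∸ T) (rotate T p)  ≡⟨ rotate-+ (value ∸ T) T p ⟨
          rotate (value ∸ T + T) p         ≡⟨ cong (λ t → rotate t p) (m∸n+n≡m (≮⇒≥ value≮T)) ⟩
          rotate value p                   ≡⟨ holds ⟩
          q                                ∎) (below (∸-monoʳ-< 0<T (≮⇒≥ value≮T)))
        where open ≡-Reasoning

  -- For cyc-c this is N + 1, where cx₁ … cx_N are the darts strictly between ca₁ and cd₁.
  gap : ∀ {x y z} → Cyc3 G x y z → ℕ
  gap = proj₁

  module _ {p q} (Q : Index p q) where
    open Index Q

    Index⇒NoReturn : NoReturn p steps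
    Index⇒NoReturn l 0<l l≤steps = Period.minimal (period p) 0<l (≤-<-trans l≤steps <period)

    Index-nonzero : q ≢ p → 0 < steps
    Index-nonzero q≢p with steps | reaches
    ... | zero  | p≡q = contradiction (sym p≡q) q≢p
    ... | suc _ | _   = s≤s z≤n

  cyc3-intro : ∀ {p q r} (Q : Index p q) (R : Index p r) →
               0 < Index.steps Q → Index.steps Q < Index.steps R → Cyc3 G p q r
  cyc3-intro Q R 0<q q<r =
    Index.steps Q , Index.steps R , 0<q , q<r , Index.reaches Q , Index.reaches R , Index⇒NoReturn R

  cyc3-trichotomy : ∀ {p q r} → vert G p ≡ vert G q → vert G p ≡ vert G r →
                    q ≢ p → r ≢ p → q ≢ r → Cyc3 G p q r ⊎ Cyc3 G p r q
  cyc3-trichotomy {p} p~q p~r q≢p r≢p q≢r with index p~q | index p~r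
  ... | Q | R with <-cmp (Index.steps Q) (Index.steps R)
  ... | tri< q<r _ _ = inj₁ (cyc3-intro Q R (Index-nonzero Q q≢p) q<r)
  ... | tri> _ _ r<q = inj₂ (cyc3-intro R Q (Index-nonzero R r≢p) r<q)
  ... | tri≈ _ q≡r _ = contradiction
        (trans (sym (Index.reaches Q)) (trans (cong (λ t → rotate t p) q≡r) (Index.reaches R))) q≢r

  cyc3-split : ∀ {f a d x} → Cyc3 G f a d → vert G f ≡ vert G x → x ≢ f → x ≢ a →
               Cyc3 G f a x ⊎ Cyc3 G f x d
  cyc3-split {f} (i , j , 0<i , i<j , reaches-a , reaches-d , noReturn) f~x x≢f x≢a
    with index f~x
  ... | X with <-cmp i (Index.steps X)
  ... | tri< i<x _ _ = inj₁ (i , Index.steps X , 0<i , i<x , reaches-a , Index.reaches X , Index⇒NoReturn X)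
  ... | tri> _ _ x<i = inj₂ (Index.steps X , j , Index-nonzero X x≢f , <-trans x<i i<j ,
                             Index.reaches X , reaches-d , noReturn)
  ... | tri≈ _ i≡x _ = contradiction
        (trans (sym (Index.reaches X)) (trans (cong (λ t → rotate t f) (sym i≡x)) reaches-a)) x≢a

  gap-reaches : ∀ {x y z} (C : Cyc3 G x y z) → rotate (gap C) x ≡ y
  gap-reaches (_ , _ , _ , _ , reaches-y , _) = reaches-y

  gap-positive : ∀ {x y z} (C : Cyc3 G x y z) → 0 < gap C
  gap-positive (_ , _ , 0<i , _) = 0<i

  cyc3-between-distinct : ∀ {x y z} (C : Cyc3 G x y z) {l} → 0 < l → l < gap C →
                          rotate l x ≢ x × rotate l x ≢ z
  cyc3-between-distinct (i , j , _ , i<j , _ , reaches-z , noReturn) 0<l l<i =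
    noReturn _ 0<l (<⇒≤ (<-trans l<i i<j)) ,
    (λ eq → NoReturn⇒injective noReturn (<-trans l<i i<j) ≤-refl (trans eq (sym reaches-z)))

  cyc3-earlier-middle : ∀ {x y z} (C : Cyc3 G x y z) {l} → 0 < l → l < gap C →
                        Σ (Cyc3 G x (rotate l x) z) λ C' → gap C' < gap C
  cyc3-earlier-middle (i , j , _ , i<j , _ , reaches-z , noReturn) {l} 0<l l<i =
    (l , j , 0<l , <-trans l<i i<j , refl , reaches-z , noReturn) , l<i

  cyc3-later-first : ∀ {x y z} (C : Cyc3 G x y z) {l} → 0 < l → l < gap C →
                     Σ (Cyc3 G (rotate l x) y z) λ C' → gap C' < gap C
  cyc3-later-first {x} (i , j , _ , i<j , reaches-y , reaches-z , noReturn) {l} 0<l l<i =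
    (i ∸ l , j ∸ l , m<n⇒0<n∸m l<i , ∸-monoˡ-< i<j (<⇒≤ l<i) ,
     shift (<⇒≤ l<i) reaches-y , shift (<⇒≤ (<-trans l<i i<j)) reaches-z , noReturn′) ,
    ∸-monoʳ-< 0<l (<⇒≤ l<i)
    where
      shift : ∀ {n w} → l ≤ n → rotate n x ≡ w → rotate (n ∸ l) (rotate l x) ≡ w
      shift {n} l≤n eq = trans (sym (rotate-+ (n ∸ l) l x))
                               (trans (cong (λ t → rotate t x) (m∸n+n≡m l≤n)) eq)
      noReturn′ : NoReturn (rotate l x) (j ∸ l)
      noReturn′ m 0<m m≤j∸l eq = noReturn m 0<m (≤-trans m≤j∸l (m∸n≤m j l))
        (rotate-injective l (begin
          rotate l (rotate m x)  ≡⟨ rotate-+ l m x ⟨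
          rotate (l + m) x       ≡⟨ cong (λ t → rotate t x) (+-comm l m) ⟩
          rotate (m + l) x       ≡⟨ rotate-+ m l x ⟩
          rotate m (rotate l x)  ≡⟨ eq ⟩
          rotate l x             ∎))
        where open ≡-Reasoning

  -- Paths

  data Path : V G → V G → List (V G) → D G → D G → Set where
    edge : ∀ {u w d} → vert G d ≡ u → target d ≡ w → Path u w [] d d
    cons : ∀ {u v w is d e f} → vert G d ≡ u → target d ≡ v → Path v w is e f →
           Path u w (v ∷ is) d f

  source-first : ∀ {u w is d f} → Path u w is d f → vert G d ≡ u
  source-first (edge eq _)   = eq
  source-first (cons eq _ _) = eq

  target-last : ∀ {u w is d f} → Path u w is d f → target f ≡ w
  target-last (edge _ eq)  = eq
  target-last (cons _ _ p) = target-last p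

  first-target : ∀ {u w is d f} → Path u w is d f → target d ∈ is ⊎ target d ≡ w
  first-target (edge _ eq)   = inj₂ eq
  first-target (cons _ eq _) = inj₁ (here eq)

  last-source : ∀ {u w is d f} → Path u w is d f → vert G f ∈ is ⊎ (f ≡ d × vert G f ≡ u)
  last-source (edge eq _)   = inj₂ (refl , eq)
  last-source (cons _ _ p) with last-source p
  ... | inj₁ f∈is          = inj₁ (there f∈is)
  ... | inj₂ (_ , f~v)     = inj₁ (here f~v)

  infixr 5 _++ᴾ_
  _++ᴾ_ : ∀ {u v w is js d e e′ f} → Path u v is d e → Path v w js e′ f → Path u w (is ++ v ∷ js) d f
  edge s t     ++ᴾ q = cons s t q
  cons s t p   ++ᴾ q = cons s t (p ++ᴾ q)

  reverseᴾ : ∀ {u w is d f} → Path u w is d f → Path w u (reverse is) (α G f) (α G d)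
  reverseᴾ (edge {d = d} s t) = edge t (trans (target-α d) s)
  reverseᴾ {is = v ∷ is} (cons s t p) =
    subst (λ js → Path _ _ js _ _) (sym (unfold-reverse v is)) (reverseᴾ p ++ᴾ reverseᴾ (edge s t))

  no-backtrack : ∀ {u v w is₁ is₂ d e e′ f} → Path u v is₁ d e → Path v w is₂ e′ f →
                 Unique (u ∷ w ∷ is₁ ++ v ∷ is₂) → e′ ≢ α G e
  no-backtrack {u} {v} {w} {is₁} {is₂} {d} {e} {e′} p q (u∉ ∷ w∉ ∷ uniq) e′≡αe =
    meet (last-source p) (first-target q)
    where
      back : target e′ ≡ vert G e
      back = trans (cong target e′≡αe) (target-α e)

      meet : vert G e ∈ is₁ ⊎ (e ≡ d × vert G e ≡ u) → target e′ ∈ is₂ ⊎ target e′ ≡ w → ⊥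
      meet (inj₁ e∈is₁)     (inj₁ e′∈is₂) =
        Unique-++⇒∉ is₁ uniq e∈is₁ (there (subst (_∈ is₂) back e′∈is₂))
      meet (inj₁ e∈is₁)     (inj₂ e′→w)   =
        Allₚ.All¬⇒¬Any w∉ (∈-++⁺ˡ (subst (_∈ is₁) (trans (sym back) e′→w) e∈is₁))
      meet (inj₂ (_ , e~u)) (inj₁ e′∈is₂) =
        Allₚ.All¬⇒¬Any u∉ (there (∈-++⁺ʳ is₁ (there (subst (_∈ is₂) (trans back e~u) e′∈is₂))))
      meet (inj₂ (_ , e~u)) (inj₂ e′→w)   =
        Allₚ.All¬⇒¬Any u∉ (here (trans (sym e~u) (trans (sym back) e′→w)))

  record Split {u w is d f} (p : Path u w is d f) (v : V G) : Set where
    field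
      is₁ is₂ : List (V G)
      e e′    : D G
      is≡     : is ≡ is₁ ++ v ∷ is₂
      before  : Path u v is₁ d e
      after   : Path v w is₂ e′ f

  split : ∀ {u w is d f v} (p : Path u w is d f) → v ∈ is → Split p v
  split (cons {is = is} s t p) (here refl) = record
    { is₁ = [] ; is₂ = is ; is≡ = refl ; before = edge s t ; after = p }
  split (cons {v = v′} s t p) (there v∈is) = record
    { is₁ = v′ ∷ is₁ ; is₂ = is₂ ; is≡ = cong (v′ ∷_) is≡ ; before = cons s t before ; after = after }
    where open Split (split p v∈is)

  data Walk : V G → V G → List (V G) → Set where
    []   : ∀ {u} → Walk u u []
    step : ∀ {u v ws} d → vert G d ≡ u → Walk (target d) v ws → Walk u v (u ∷ ws)

  walk⇒path : ∀ {u v ws y} → vert G y ≡ u → Walk (target y) v ws → ∃ λ x → Path u v ws y x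
  walk⇒path s []            = _ , edge s refl
  walk⇒path s (step d s′ w) = _ , cons s refl (proj₂ (walk⇒path s′ w))

  -- Type I subgraphs

  IsPath⇒Path : ∀ {n u w} (vs : Vec (V G) n) (ds : Vec (D G) (suc n)) →
                IsPath G (u Vec.∷ (vs ∷ʳ w)) ds → Path u w (Vec.toList vs) (Vec.head ds) (Vec.last ds)
  IsPath⇒Path Vec.[]       (d Vec.∷ Vec.[]) isPath = edge (proj₁ (isPath zero)) (proj₂ (isPath zero))
  IsPath⇒Path (v Vec.∷ vs) (d Vec.∷ ds)     isPath =
    cons (proj₁ (isPath zero)) (proj₂ (isPath zero)) (IsPath⇒Path vs ds (isPath ∘ suc))

  record VecPath (u w : V G) (is : List (V G)) (d f : D G) : Set where
    field
      darts  : Vec (D G) (suc (length is))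
      isPath : IsPath G (u Vec.∷ (Vec.fromList is ∷ʳ w)) darts
      head≡  : Vec.head darts ≡ d
      last≡  : Vec.last darts ≡ f

  Path⇒VecPath : ∀ {u w is d f} → Path u w is d f → VecPath u w is d f
  Path⇒VecPath (edge s t) = record
    { darts = _ Vec.∷ Vec.[] ; isPath = λ { zero → s , t } ; head≡ = refl ; last≡ = refl }
  Path⇒VecPath (cons s t p) = record
    { darts = _ Vec.∷ darts ; isPath = λ { zero → s , t ; (suc i) → isPath i } ; head≡ = refl ; last≡ = last≡ }
    where open VecPath (Path⇒VecPath p)

  cyc3-cong : ∀ {x x′ y y′ z z′} → x ≡ x′ → y ≡ y′ → z ≡ z′ → Cyc3 G x y z → Cyc3 G x′ y′ z′
  cyc3-cong refl refl refl C = C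

  -- TypeI with vertex lists and inductive paths whose end darts are indices, so
  -- that splicing paths needs no transport.
  record Theta : Set where
    field
      c b            : V G
      as ds fs       : List (V G)
      a₁ aₙ d₁ dₘ f₁ fₖ : D G
      Pa             : Path c b as a₁ aₙ
      Pd             : Path c b ds d₁ dₘ
      Pf             : Path c b fs f₁ fₖ
      distinct       : Unique (c ∷ b ∷ as ++ ds ++ fs)
      cyc-c          : Cyc3 G a₁ d₁ f₁
      cyc-b          : Cyc3 G (α G fₖ) (α G aₙ) (α G dₘ)

    VH-c : List (V G)
    VH-c = b ∷ as ++ ds ++ fs

    IsCx : D G → Set
    IsCx y = Σ ℕ λ l → 0 < l × rotate l a₁ ≡ y × (∀ l′ → 0 < l′ → l′ ≤ l → rotate l′ a₁ ≢ d₁)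

    G₁-avoids : Set
    G₁-avoids = ∀ y e → IsCx y → WalkAvoid G c y e → vert G e ∉ VH-c × target e ∉ VH-c

  TypeI⇒Theta : TypeI G → Theta
  TypeI⇒Theta H = record
    { Pa = IsPath⇒Path as Pa Pa-path ; Pd = IsPath⇒Path ds Pd Pd-path ; Pf = IsPath⇒Path fs Pf Pf-path
    ; distinct = distinct ; cyc-c = cyc-c ; cyc-b = cyc-b }
    where open TypeI H

  module _ (θ : Theta) where
    open Theta θ
    private
      module A = VecPath (Path⇒VecPath Pa)
      module D′ = VecPath (Path⇒VecPath Pd)
      module F = VecPath (Path⇒VecPath Pf)

      VH-c≡ : b ∷ Vec.toList (Vec.fromList as) ++ Vec.toList (Vec.fromList ds)
                ++ Vec.toList (Vec.fromList fs) ≡ VH-c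
      VH-c≡ = cong₂ (λ xs ys → b ∷ xs ++ ys) (toList∘fromList as)
                (cong₂ _++_ (toList∘fromList ds) (toList∘fromList fs))

    Theta⇒TypeI : TypeI G
    Theta⇒TypeI = record
      { c = c ; b = b ; as = Vec.fromList as ; ds = Vec.fromList ds ; fs = Vec.fromList fs
      ; Pa = A.darts ; Pd = D′.darts ; Pf = F.darts
      ; Pa-path = A.isPath ; Pd-path = D′.isPath ; Pf-path = F.isPath
      ; distinct = subst Unique (sym (cong (c ∷_) VH-c≡)) distinct
      ; cyc-c = cyc3-cong (sym A.head≡) (sym D′.head≡) (sym F.head≡) cyc-c
      ; cyc-b = cyc3-cong (cong (α G) (sym F.last≡)) (cong (α G) (sym A.last≡))
                          (cong (α G) (sym D′.last≡)) cyc-b }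

    private
      IsCx-from : ∀ {y} → TypeI.IsCx Theta⇒TypeI y → IsCx y
      IsCx-from (l , 0<l , reaches , before-d) =
        l , 0<l , trans (cong (rotate l) (sym A.head≡)) reaches ,
        λ l′ 0<l′ l′≤l eq → before-d l′ 0<l′ l′≤l
          (trans (cong (rotate l′) A.head≡) (trans eq (sym D′.head≡)))

    G₁-avoids⇒TypeA : G₁-avoids → TypeA G
    G₁-avoids⇒TypeA avoids = Theta⇒TypeI , λ y e isCx walk →
      let e∉ , αe∉ = avoids y e (IsCx-from isCx) walk
      in e∉ ∘ subst (vert G e ∈_) VH-c≡ , αe∉ ∘ subst (target e ∈_) VH-c≡

  -- Walks avoiding c

  module Search (T : List (V G)) (c : V G) where
    open DecMembership (Finₚ._≟_ {nV G}) using (_∈?_)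

    Fresh : V G → Set
    Fresh w = w ∉ T × w ≢ c

    Reach : ℕ → V G → Set
    Reach zero    u = u ∈ T
    Reach (suc k) u = u ∈ T ⊎ (Fresh u × Σ (D G) λ d → vert G d ≡ u × Reach k (target d))

    reach? : ∀ k → Decidable (Reach k)
    reach? zero    u = u ∈? T
    reach? (suc k) u = (u ∈? T) ⊎-dec ((¬? (u ∈? T) ×-dec ¬? (u Finₚ.≟ c)) ×-dec
                         Finₚ.any? (λ d → (vert G d Finₚ.≟ u) ×-dec reach? k (target d)))

    reach-step : ∀ {k u d} → u ≢ c → vert G d ≡ u → Reach k (target d) → Reach (suc k) u
    reach-step {u = u} u≢c s r with u ∈? T
    ... | yes u∈T = inj₁ u∈T
    ... | no  u∉T = inj₂ ((u∉T , u≢c) , _ , s , r)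

    record FreshWalk (u : V G) : Set where
      field
        v      : V G
        ws     : List (V G)
        walk   : Walk u v ws
        v∈T    : v ∈ T
        unique : Unique ws
        fresh  : All Fresh ws

    suffix-from : ∀ {x v ws u} → Walk x v ws → u ∈ ws →
                  ∃₂ λ p q → ws ≡ p ++ u ∷ q × Walk u v (u ∷ q)
    suffix-from (step d s w) (here refl)  = [] , _ , refl , step d s w
    suffix-from {x} (step d s w) (there u∈ws) with suffix-from w u∈ws
    ... | p , q , ws≡ , w′ = x ∷ p , q , cong (x ∷_) ws≡ , w′

    Reach⇒FreshWalk : ∀ k {u} → Reach k u → FreshWalk u
    Reach⇒FreshWalk zero          u∈T       = record { walk = [] ; v∈T = u∈T ; unique = [] ; fresh = [] }
    Reach⇒FreshWalk (suc k)       (inj₁ u∈T) = Reach⇒FreshWalk zero u∈T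
    Reach⇒FreshWalk (suc k) {u} (inj₂ (fresh-u , d , s , r)) with Reach⇒FreshWalk k r
    ... | W with u ∈? FreshWalk.ws W
    ...   | no  u∉ws = record
      { walk = step d s walk ; v∈T = v∈T ; unique = Allₚ.¬Any⇒All¬ _ u∉ws ∷ unique
      ; fresh = fresh-u ∷ fresh }
      where open FreshWalk W
    ...   | yes u∈ws with suffix-from (FreshWalk.walk W) u∈ws
    ...     | p , q , ws≡ , walk′ = record
      { walk = walk′ ; v∈T = v∈T
      ; unique = Unique-++⁻ʳ p (subst Unique ws≡ unique)
      ; fresh = Allₚ.++⁻ʳ p (subst (All Fresh) ws≡ fresh) }
      where open FreshWalk W

    walk⇒reach : ∀ {k u v ws} → Walk u v ws → v ∈ T → All Fresh ws → length ws ≤ k → Reach k u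
    walk⇒reach {zero}  []             v∈T _                _         = v∈T
    walk⇒reach {suc k} []             v∈T _                _         = inj₁ v∈T
    walk⇒reach {suc k} (step d s w)   v∈T (fresh-u ∷ fresh) (s≤s len) =
      inj₂ (fresh-u , d , s , walk⇒reach w v∈T fresh len)

    reach-within-nV : ∀ {k u} → Reach k u → Reach (nV G) u
    reach-within-nV {k} r = walk⇒reach walk v∈T fresh (Unique⇒length≤ unique)
      where open FreshWalk (Reach⇒FreshWalk k r)

    walk-target-reach : ∀ {e e″} → WalkAvoid G c e e″ → target e″ ∈ T → ∃ λ k → Reach k (target e)
    walk-target-reach (one e)          ∈T = 0 , ∈T
    walk-target-reach (step ≢c s walk) ∈T with walk-target-reach walk ∈T
    ... | k , r = suc k , reach-step ≢c s r

    walk-source-reach : ∀ {e e″} → WalkAvoid G c e e″ → vert G e″ ∈ T →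
                        vert G e″ ≡ vert G e ⊎ ∃ λ k → Reach k (target e)
    walk-source-reach (one e)          ∈T = inj₁ refl
    walk-source-reach (step ≢c s walk) ∈T with walk-source-reach walk ∈T
    ... | inj₁ e″~e′  = inj₂ (0 , subst (_∈ T) (trans e″~e′ s) ∈T)
    ... | inj₂ (k , r) = inj₂ (suc k , reach-step ≢c s r)

  -- Rerouting

  module Reroute (θ : Theta) where
    open Theta θ
    open Search VH-c c
    open import Algebra.Solver.CommutativeMonoid (++-commutativeMonoid {A = V G})
      using (solve; _⊜_; _⊕_)

    Smaller : Set
    Smaller = Σ Theta λ θ′ → gap (Theta.cyc-c θ′) < gap cyc-c

    -- Some cxₗ starts a walk to V(H) ∖ {c} avoiding c, i.e. G₁ meets V(H) ∖ {c}.
    Bridge : Set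
    Bridge = ∃ λ l → l < gap cyc-c × (0 < l × Reach (nV G) (target (rotate l a₁)))

    bridge? : Dec Bridge
    bridge? = anyUpTo? (λ l → (0 <? l) ×-dec reach? (nV G) (target (rotate l a₁))) (gap cyc-c)

    c∉VH-c : c ∉ VH-c
    c∉VH-c = Unique[x∷xs]⇒x∉xs distinct

    source-rotate : ∀ l → vert G (rotate l a₁) ≡ c
    source-rotate l = trans (vert-rotate l a₁) (source-first Pa)

    no-bridge⇒G₁-avoids : ¬ Bridge → G₁-avoids
    no-bridge⇒G₁-avoids none y e (l , 0<l , reaches-y , before-d) walk =
      (λ e∈ → source-case (walk-source-reach walk e∈) e∈) , bridge ∘ walk-target-reach walk
      where
        l<gap : l < gap cyc-c
        l<gap with l <? gap cyc-c
        ... | yes l<gap = l<gap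
        ... | no  l≮gap = contradiction (gap-reaches cyc-c)
                            (before-d (gap cyc-c) (gap-positive cyc-c) (≮⇒≥ l≮gap))

        bridge : ¬ ∃ (λ k → Reach k (target y))
        bridge (k , r) = none (l , l<gap , 0<l ,
          subst (Reach (nV G) ∘ target) (sym reaches-y) (reach-within-nV r))

        source-case : vert G e ≡ vert G y ⊎ ∃ (λ k → Reach k (target y)) → vert G e ∉ VH-c
        source-case (inj₁ e~y) = c∉VH-c ∘ subst (_∈ VH-c)
          (trans e~y (trans (cong (vert G) (sym reaches-y)) (source-rotate l)))
        source-case (inj₂ r)   = λ _ → bridge r

    module Rerouting {l} (0<l : 0 < l) (l<gap : l < gap cyc-c)
                     (W : FreshWalk (target (rotate l a₁))) where
      open FreshWalk W

      y : D G
      y = rotate l a₁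

      x : D G
      x = proj₁ (walk⇒path (source-rotate l) walk)

      X : Path c v ws y x
      X = proj₂ (walk⇒path (source-rotate l) walk)

      y≢a₁ : y ≢ a₁
      y≢a₁ = proj₁ (cyc3-between-distinct cyc-c 0<l l<gap)

      y≢f₁ : y ≢ f₁
      y≢f₁ = proj₂ (cyc3-between-distinct cyc-c 0<l l<gap)

      y-replaces-a₁ : Σ (Cyc3 G y d₁ f₁) λ C → gap C < gap cyc-c
      y-replaces-a₁ = cyc3-later-first cyc-c 0<l l<gap

      y-replaces-d₁ : Σ (Cyc3 G a₁ y f₁) λ C → gap C < gap cyc-c
      y-replaces-d₁ = cyc3-earlier-middle cyc-c 0<l l<gap

      ws-fresh : ∀ {t} → t ∈ ws → Fresh t
      ws-fresh = All.lookup fresh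

      x∉VH-c : vert G x ∉ VH-c
      x∉VH-c with last-source X
      ... | inj₁ x∈ws      = proj₁ (ws-fresh x∈ws)
      ... | inj₂ (_ , x~c) = c∉VH-c ∘ subst (_∈ VH-c) x~c

      x-at-c : vert G x ≡ c → x ≡ y
      x-at-c x~c with last-source X
      ... | inj₁ x∈ws      = contradiction x~c (proj₂ (ws-fresh x∈ws))
      ... | inj₂ (x≡y , _) = x≡y

      last-differs : ∀ {w Q p q} → Path c w Q p q → Q ⊆ VH-c → p ≢ y → α G x ≢ α G q
      last-differs P Q⊆ p≢y αx≡αq with last-source P | α-injective αx≡αq
      ... | inj₁ q∈Q        | refl = x∉VH-c (Q⊆ q∈Q)
      ... | inj₂ (q≡p , q~c) | refl = p≢y (trans (sym q≡p) (x-at-c q~c))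

      end-not-first : ∀ {w Q p q} → Path w b Q p q → Q ⊆ VH-c → α G x ≢ p
      end-not-first P Q⊆ refl with first-target P
      ... | inj₁ ∈Q = x∉VH-c (subst (_∈ VH-c) (target-α x) (Q⊆ ∈Q))
      ... | inj₂ →b = x∉VH-c (subst (_∈ VH-c) (trans (sym →b) (target-α x)) (here refl))

      distinct-by : ∀ {N} E {O} → O ≡ c ∷ VH-c → N ++ E ↭ O ++ ws → Unique N
      distinct-by {N} E refl perm =
        Unique-++⁻ˡ N (Unique-resp-↭ (↭-sym perm) (++⁺ distinct unique disjoint))
        where
          disjoint : ∀ {t} → ¬ (t ∈ c ∷ VH-c × t ∈ ws)
          disjoint (here t≡c  , t∈ws) = proj₂ (ws-fresh t∈ws) t≡c
          disjoint (there t∈H , t∈ws) = proj₁ (ws-fresh t∈ws) t∈H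

      as⊆ : as ⊆ VH-c
      as⊆ = there ∘ ∈-++⁺ˡ

      ds⊆ : ds ⊆ VH-c
      ds⊆ = there ∘ ∈-++⁺ʳ as ∘ ∈-++⁺ˡ

      fs⊆ : fs ⊆ VH-c
      fs⊆ = there ∘ ∈-++⁺ʳ as ∘ ∈-++⁺ʳ ds

      via-a : v ∈ as → Smaller
      via-a v∈as = record
        { Pa = X ++ᴾ after ; Pd = Pd ; Pf = Pf
        ; distinct = distinct-by is₁ (cong (λ as → c ∷ b ∷ as ++ ds ++ fs) (sym is≡))
            (solve 8 (λ c b v ws is₁ is₂ ds fs →
               (c ⊕ b ⊕ (ws ⊕ v ⊕ is₂) ⊕ ds ⊕ fs) ⊕ is₁
             ⊜ (c ⊕ b ⊕ (is₁ ⊕ v ⊕ is₂) ⊕ ds ⊕ fs) ⊕ ws)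
             ↭-refl [ c ] [ b ] [ v ] ws is₁ is₂ ds fs)
        ; cyc-c = proj₁ y-replaces-a₁ ; cyc-b = cyc-b } , proj₂ y-replaces-a₁
        where open Split (split Pa v∈as)

      via-d : v ∈ ds → Smaller
      via-d v∈ds = record
        { Pa = Pa ; Pd = X ++ᴾ after ; Pf = Pf
        ; distinct = distinct-by is₁ (cong (λ ds → c ∷ b ∷ as ++ ds ++ fs) (sym is≡))
            (solve 8 (λ c b v ws is₁ is₂ as fs →
               (c ⊕ b ⊕ as ⊕ (ws ⊕ v ⊕ is₂) ⊕ fs) ⊕ is₁
             ⊜ (c ⊕ b ⊕ as ⊕ (is₁ ⊕ v ⊕ is₂) ⊕ fs) ⊕ ws)
             ↭-refl [ c ] [ b ] [ v ] ws is₁ is₂ as fs)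
        ; cyc-c = proj₁ y-replaces-d₁ ; cyc-b = cyc-b } , proj₂ y-replaces-d₁
        where open Split (split Pd v∈ds)

      X-ending-at-b : v ≡ b → Path c b ws y x
      X-ending-at-b v≡b = subst (λ w → Path c w ws y x) v≡b X

      via-b : v ≡ b → Smaller
      via-b v≡b with cyc3-split cyc-b (trans (target-last Pf) (sym (trans (target-last X) v≡b)))
                                      (last-differs Pf fs⊆ (y≢f₁ ∘ sym)) (last-differs Pa as⊆ (y≢a₁ ∘ sym))
      ... | inj₁ C = record
        { Pa = Pa ; Pd = X-ending-at-b v≡b ; Pf = Pf
        ; distinct = distinct-by ds refl
            (solve 6 (λ c b as ws ds fs →
               (c ⊕ b ⊕ as ⊕ ws ⊕ fs) ⊕ ds
             ⊜ (c ⊕ b ⊕ as ⊕ ds ⊕ fs) ⊕ ws)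
             ↭-refl [ c ] [ b ] as ws ds fs)
        ; cyc-c = proj₁ y-replaces-d₁ ; cyc-b = C } , proj₂ y-replaces-d₁
      ... | inj₂ C = record
        { Pa = X-ending-at-b v≡b ; Pd = Pd ; Pf = Pf
        ; distinct = distinct-by as refl
            (solve 6 (λ c b as ws ds fs →
               (c ⊕ b ⊕ ws ⊕ ds ⊕ fs) ⊕ as
             ⊜ (c ⊕ b ⊕ as ⊕ ds ⊕ fs) ⊕ ws)
             ↭-refl [ c ] [ b ] as ws ds fs)
        ; cyc-c = proj₁ y-replaces-a₁ ; cyc-b = C } , proj₂ y-replaces-a₁

      module Via-f (v∈fs : v ∈ fs) where
        open Split (split Pf v∈fs)

        is₁⊆ : is₁ ⊆ VH-c
        is₁⊆ = fs⊆ ∘ subst (_ ∈_) (sym is≡) ∘ ∈-++⁺ˡ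

        is₂⊆ : is₂ ⊆ VH-c
        is₂⊆ = fs⊆ ∘ subst (_ ∈_) (sym is≡) ∘ ∈-++⁺ʳ is₁ ∘ there

        distinct-Pf : Unique (c ∷ b ∷ is₁ ++ v ∷ is₂)
        distinct-Pf = subst (λ fs → Unique (c ∷ b ∷ fs)) is≡ (Unique-++⁻ˡ (c ∷ b ∷ fs) (Unique-resp-↭
          (solve 5 (λ c b as ds fs → c ⊕ b ⊕ as ⊕ ds ⊕ fs ⊜ (c ⊕ b ⊕ fs) ⊕ as ⊕ ds)
           ↭-refl [ c ] [ b ] as ds fs) distinct))

        fs≡ : _≡_ {A = List (V G)} (c ∷ b ∷ as ++ ds ++ is₁ ++ v ∷ is₂) (c ∷ VH-c)
        fs≡ = cong (λ fs → c ∷ b ∷ as ++ ds ++ fs) (sym is≡)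

        rerouted : Smaller
        rerouted with cyc3-trichotomy (trans (target-last before) (sym (source-first after)))
                                      (trans (target-last before) (sym (target-last X)))
                                      (no-backtrack before after distinct-Pf)
                                      (last-differs before is₁⊆ (y≢f₁ ∘ sym))
                                      (end-not-first after is₂⊆ ∘ sym)
        ... | inj₁ C = record
          { b = v ; Pa = Pa ++ᴾ reverseᴾ after ; Pd = X ; Pf = before
          ; distinct = distinct-by ds fs≡ (↭-via-reverse is₂ _
              (solve 8 (λ c v b as r ws is₁ ds →
                 (c ⊕ v ⊕ (as ⊕ b ⊕ r) ⊕ ws ⊕ is₁) ⊕ ds ⊜ r ⊕ c ⊕ v ⊕ b ⊕ as ⊕ ws ⊕ is₁ ⊕ ds)
               ↭-refl [ c ] [ v ] [ b ] as (reverse is₂) ws is₁ ds)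
              (solve 8 (λ c v b as r ws is₁ ds →
                 r ⊕ c ⊕ v ⊕ b ⊕ as ⊕ ws ⊕ is₁ ⊕ ds ⊜ (c ⊕ b ⊕ as ⊕ ds ⊕ is₁ ⊕ v ⊕ r) ⊕ ws)
               ↭-refl [ c ] [ v ] [ b ] as is₂ ws is₁ ds))
          ; cyc-c = proj₁ y-replaces-d₁ ; cyc-b = cyc3-cong refl (sym (α-inv G _)) refl C }
          , proj₂ y-replaces-d₁
        ... | inj₂ C = record
          { b = v ; Pa = X ; Pd = Pd ++ᴾ reverseᴾ after ; Pf = before
          ; distinct = distinct-by as fs≡ (↭-via-reverse is₂ _
              (solve 8 (λ c v b ds r ws is₁ as →
                 (c ⊕ v ⊕ ws ⊕ (ds ⊕ b ⊕ r) ⊕ is₁) ⊕ as ⊜ r ⊕ c ⊕ v ⊕ b ⊕ ds ⊕ ws ⊕ is₁ ⊕ as)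
               ↭-refl [ c ] [ v ] [ b ] ds (reverse is₂) ws is₁ as)
              (solve 8 (λ c v b ds r ws is₁ as →
                 r ⊕ c ⊕ v ⊕ b ⊕ ds ⊕ ws ⊕ is₁ ⊕ as ⊜ (c ⊕ b ⊕ as ⊕ ds ⊕ is₁ ⊕ v ⊕ r) ⊕ ws)
               ↭-refl [ c ] [ v ] [ b ] ds is₂ ws is₁ as))
          ; cyc-c = proj₁ y-replaces-a₁ ; cyc-b = cyc3-cong refl refl (sym (α-inv G _)) C }
          , proj₂ y-replaces-a₁

      rerouted : Smaller
      rerouted with v∈T
      ... | here v≡b = via-b v≡b
      ... | there v∈ with ∈-++⁻ as v∈
      ...   | inj₁ v∈as = via-a v∈as
      ...   | inj₂ v∈′ with ∈-++⁻ ds v∈′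
      ...     | inj₁ v∈ds = via-d v∈ds
      ...     | inj₂ v∈fs = Via-f.rerouted v∈fs

    avoids-or-smaller : G₁-avoids ⊎ Smaller
    avoids-or-smaller with bridge?
    ... | no  none                   = inj₁ (no-bridge⇒G₁-avoids none)
    ... | yes (_ , l<gap , 0<l , r)  = inj₂ (Rerouting.rerouted 0<l l<gap (Reach⇒FreshWalk (nV G) r))

  Theta⇒TypeA : (θ : Theta) → Acc _<_ (gap (Theta.cyc-c θ)) → TypeA G
  Theta⇒TypeA θ (acc smaller) with Reroute.avoids-or-smaller θ
  ... | inj₁ avoids      = G₁-avoids⇒TypeA θ avoids
  ... | inj₂ (θ′ , θ′<θ) = Theta⇒TypeA θ′ (smaller θ′<θ)

lemma3p7 : (G : RibbonGraph) → Connected G → ¬ Planar G → TypeI G → TypeA G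
lemma3p7 G _ _ H = Theta⇒TypeA G (TypeI⇒Theta G H) (<-wellFounded _)
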